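{- Let $m,n\ge 0$ be integers and let $G$ be an $(m,n)$-colored mixed graph. Two distinct vertices $u,v$ of $G$ form a relative $(m,n)$-clique (i.e. $f(u)\neq f(v)$ for every $(m,n)$-colored mixed graph $H$ and every homomorphism $f:G\to H$) if and only if $u$ and $v$ are adjacent or $u$ and $v$ are connected by a special 2-path.
   Context: An $(m,n)$-colored mixed graph $G=(V,A\cup E)$ has vertex set $V$, a set $A$ of arcs each colored with one of $m$ colors, and a set $E$ of edges each colored with one of $n$ colors, such that the underlying undirected graph is simple (between two vertices there is at most one arc or edge). A homomorphism $f:G\to H$ of $(m,n)$-colored mixed graphs is a map $V(G)\to V(H)$ such that if $uv$ is an arc (resp. edge) of color $c$ in $G$ then $f(u)f(v)$ is an arc (resp. edge) of color $c$ in $H$ (arcs keep their direction). A set $R$ of vertices of $G$ is a relative $(m,n)$-clique if no two distinct vertices of $R$ have the same image under any homomorphism of $G$ to any $(m,n)$-colored mixed graph. If $uvw$ is a path of length 2 in the underlying graph of $G$, it is a special 2-path if one of the following holds: (i) $uv$ and $vw$ are edges of different colors; (ii) $uv$ and $vw$ are arcs (directed $u\to v$ and $v\to w$, of any colors); (iii) $uv$ and $wv$ are arcs (directed $u\to v$ and $w\to v$) of different colors; (iv) $vu$ and $vw$ are arcs (directed $v\to u$ and $v\to w$) of different colors; (v) exactly one of $uv$, $vw$ is an edge. Two vertices are connected by a special 2-path if there is a special 2-path with them as its endpoints. -}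

module Defs where

open import Data.Nat using (ℕ)
open import Data.Fin using (Fin)
open import Data.Maybe using (Maybe; just; nothing; map)
open import Data.Product using (∃; _×_; _,_)
open import Data.Sum using (_⊎_)
open import Relation.Binary.PropositionalEquality using (_≡_; _≢_)

-- The connection between an ordered pair of vertices (x , y), seen from x:
--   out c : an arc x → y of color c   (c among the m arc colors)
--   inn c : an arc y → x of color c
--   und c : an (undirected) edge xy of color c (c among the n edge colors)
data Conn (m n : ℕ) : Set where
  out : Fin m → Conn m n
  inn : Fin m → Conn m n
  und : Fin n → Conn m n

rev : ∀ {m n} → Conn m n → Conn m n
rev (out c) = inn c
rev (inn c) = out c
rev (und c) = und c

-- A finite (m,n)-colored mixed graph on vertex set Fin order.
-- 'adj x y' is the unique arc/edge between x and y (if any), seen from x;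
-- having a single value per pair encodes that the underlying graph is simple
-- (at most one arc or edge between two vertices); 'loopless' forbids loops.
record MixedGraph (m n : ℕ) : Set where
  field
    order    : ℕ
    adj      : Fin order → Fin order → Maybe (Conn m n)
    loopless : ∀ x → adj x x ≡ nothing
    symm     : ∀ x y → adj y x ≡ map rev (adj x y)

open MixedGraph public

Vertex : ∀ {m n} → MixedGraph m n → Set
Vertex G = Fin (order G)

record Hom {m n} (G H : MixedGraph m n) : Set where
  field
    fun      : Vertex G → Vertex H
    preserve : ∀ x y (l : Conn m n) → adj G x y ≡ just l → adj H (fun x) (fun y) ≡ just l

open Hom public

RelativeClique : ∀ {m n} (G : MixedGraph m n) → (Vertex G → Set) → Set
RelativeClique {m} {n} G R =
  ∀ (H : MixedGraph m n) (f : Hom G H) (x y : Vertex G) →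
  R x → R y → x ≢ y → fun f x ≢ fun f y

pair : ∀ {m n} {G : MixedGraph m n} → Vertex G → Vertex G → Vertex G → Set
pair u v x = (x ≡ u) ⊎ (x ≡ v)

Adjacent : ∀ {m n} (G : MixedGraph m n) → Vertex G → Vertex G → Set
Adjacent G u v = ∃ λ l → adj G u v ≡ just l

-- SpecialLabels a b : for a path u v w with a = connection of uv seen from u
-- and b = connection of vw seen from v, the path is special.
data SpecialLabels {m n : ℕ} : Conn m n → Conn m n → Set where
  edges    : ∀ {c d} → c ≢ d → SpecialLabels (und c) (und d)
  directed : ∀ {c d} → SpecialLabels (out c) (out d)
  sinkD    : ∀ {c d} → c ≢ d → SpecialLabels (out c) (inn d)
  sourceD  : ∀ {c d} → c ≢ d → SpecialLabels (inn c) (out d)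
  edgeArc₁ : ∀ {c d} → SpecialLabels (und c) (out d)
  edgeArc₂ : ∀ {c d} → SpecialLabels (und c) (inn d)
  arcEdge₁ : ∀ {c d} → SpecialLabels (out c) (und d)
  arcEdge₂ : ∀ {c d} → SpecialLabels (inn c) (und d)

-- u v w is a special 2-path (a path of length 2 in the underlying graph;
-- u ≢ v and v ≢ w follow from looplessness).
Special2Path : ∀ {m n} (G : MixedGraph m n) → Vertex G → Vertex G → Vertex G → Set
Special2Path G u v w =
  u ≢ w × ∃ λ a → ∃ λ b → adj G u v ≡ just a × adj G v w ≡ just b × SpecialLabels a b

SpecialConnected : ∀ {m n} (G : MixedGraph m n) → Vertex G → Vertex G → Set
SpecialConnected G u w = ∃ λ v → Special2Path G u v w ⊎ Special2Path G w v u

module Submission where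

-- (⇐) A homomorphism f sends an arc/edge to an arc/edge, and loops do not
--     exist, so adjacent vertices keep distinct images.  A special 2-path
--     u y v is sent to a walk f u, f y, f v with the same labels a, b; if
--     f u = f v then, by the symmetry of adjacency, b is the reverse of a,
--     and no pair of labels (a , rev a) is special.
-- (⇒) Suppose u, v are non-adjacent and not joined by a special 2-path.
--     Any two different labels a ≠ b on uy and vy would make u y v or v y u
--     special, so every common neighbour y sees u and v through the SAME
--     label.  Then identifying v with u is harmless: the graph whose
--     adjacency between x and y is that of G, or failing that the one between
--     the images of x and y under u ↦ v, is a mixed graph, and the map sending
--     v to u (fixing all other vertices) is a homomorphism into it merging u
--     and v; so {u , v} is no relative clique.
--     The split between "some clash" and "no clash" is decided by exhaustive
--     search over the finitely many vertices.

open import Defs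
open import Data.Nat using (ℕ)
open import Data.Fin using (Fin; _≟_)
open import Data.Fin.Properties using (any?)
open import Data.Maybe using (Maybe; just; nothing; map; _<∣>_)
open import Data.Maybe.Properties using (just-injective; map-<∣>)
open import Data.Product using (∃; _,_)
open import Data.Sum using (_⊎_; inj₁; inj₂)
open import Data.Empty using (⊥; ⊥-elim)
open import Function.Bundles using (_⇔_; mk⇔)
open import Relation.Nullary using (Dec; yes; no; ¬_)
open import Relation.Nullary.Decidable using (map′; decidable-stable)
open import Relation.Binary.PropositionalEquality
  using (_≡_; _≢_; refl; sym; trans; cong; cong₂; subst; subst₂)

module _ {k : ℕ} (a b : Fin k) where

  redirect : Fin k → Fin k
  redirect x with x ≟ a
  ... | yes _ = b
  ... | no  _ = x

  redirect-hit : redirect a ≡ b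
  redirect-hit with a ≟ a
  ... | yes _   = refl
  ... | no  a≢a = ⊥-elim (a≢a refl)

  redirect-miss : ∀ {x} → x ≢ a → redirect x ≡ x
  redirect-miss {x} x≢a with x ≟ a
  ... | yes x≡a = ⊥-elim (x≢a x≡a)
  ... | no  _   = refl

module _ {m n : ℕ} where

  _≟ᶜ_ : (a b : Conn m n) → Dec (a ≡ b)
  out c ≟ᶜ out d = map′ (cong out) (λ { refl → refl }) (c ≟ d)
  inn c ≟ᶜ inn d = map′ (cong inn) (λ { refl → refl }) (c ≟ d)
  und c ≟ᶜ und d = map′ (cong und) (λ { refl → refl }) (c ≟ d)
  out _ ≟ᶜ inn _ = no λ ()
  out _ ≟ᶜ und _ = no λ ()
  inn _ ≟ᶜ out _ = no λ ()
  inn _ ≟ᶜ und _ = no λ ()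
  und _ ≟ᶜ out _ = no λ ()
  und _ ≟ᶜ inn _ = no λ ()

  rev-involutive : (a : Conn m n) → rev (rev a) ≡ a
  rev-involutive (out _) = refl
  rev-involutive (inn _) = refl
  rev-involutive (und _) = refl

  adj-flip : (G : MixedGraph m n) {x y : Vertex G} {a : Conn m n} →
    adj G x y ≡ just a → adj G y x ≡ just (rev a)
  adj-flip G {x} {y} e = trans (symm G x y) (cong (map rev) e)

  ¬special-back : (a : Conn m n) → ¬ SpecialLabels a (rev a)
  ¬special-back (und _) (edges c≢c)   = c≢c refl
  ¬special-back (out _) (sinkD c≢c)   = c≢c refl
  ¬special-back (inn _) (sourceD c≢c) = c≢c refl

  clash⇒special : (a b : Conn m n) → a ≢ b →
    SpecialLabels a (rev b) ⊎ SpecialLabels b (rev a)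
  clash⇒special (und c) (und d) a≢b = inj₁ (edges λ c≡d → a≢b (cong und c≡d))
  clash⇒special (und _) (out _) _   = inj₁ edgeArc₂
  clash⇒special (und _) (inn _) _   = inj₁ edgeArc₁
  clash⇒special (out _) (und _) _   = inj₁ arcEdge₁
  clash⇒special (out c) (out d) a≢b = inj₁ (sinkD λ c≡d → a≢b (cong out c≡d))
  clash⇒special (out _) (inn _) _   = inj₁ directed
  clash⇒special (inn _) (und _) _   = inj₁ arcEdge₂
  clash⇒special (inn _) (out _) _   = inj₂ directed
  clash⇒special (inn c) (inn d) a≢b = inj₁ (sourceD λ c≡d → a≢b (cong inn c≡d))

  adjacent⇒distinct : (H : MixedGraph m n) {p q : Vertex H} {a : Conn m n} →
    adj H p q ≡ just a → p ≢ q
  adjacent⇒distinct H {p} e refl with trans (sym e) (loopless H p)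
  ... | ()

  special⇒distinct : (H : MixedGraph m n) {p q r : Vertex H} {a b : Conn m n} →
    adj H p q ≡ just a → adj H q r ≡ just b → SpecialLabels a b → p ≢ r
  special⇒distinct H {a = a} {b} epq eqp s refl = ¬special-back a (subst (SpecialLabels a) b≡rev-a s)
    where
    b≡rev-a : b ≡ rev a
    b≡rev-a = just-injective (trans (sym eqp) (adj-flip H epq))

  separated : (G H : MixedGraph m n) (f : Hom G H) {u v : Vertex G} →
    Adjacent G u v ⊎ SpecialConnected G u v → fun f u ≢ fun f v
  separated G H f {u} {v} (inj₁ (l , e)) = adjacent⇒distinct H (preserve f u v l e)
  separated G H f {u} {v} (inj₂ (y , inj₁ (_ , a , b , e₁ , e₂ , s))) =
    special⇒distinct H (preserve f u y a e₁) (preserve f y v b e₂) s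
  separated G H f {u} {v} (inj₂ (y , inj₂ (_ , a , b , e₁ , e₂ , s))) fu≡fv =
    special⇒distinct H (preserve f v y a e₁) (preserve f y u b e₂) s (sym fu≡fv)

  pair-clique : (G : MixedGraph m n) (u v : Vertex G) →
    (∀ H (f : Hom G H) → fun f u ≢ fun f v) → RelativeClique G (pair {G = G} u v)
  pair-clique G u v sep H f x y (inj₁ refl) (inj₁ refl) x≢y = ⊥-elim (x≢y refl)
  pair-clique G u v sep H f x y (inj₁ refl) (inj₂ refl) _   = sep H f
  pair-clique G u v sep H f x y (inj₂ refl) (inj₁ refl) _   = λ e → sep H f (sym e)
  pair-clique G u v sep H f x y (inj₂ refl) (inj₂ refl) x≢y = ⊥-elim (x≢y refl)

  <∣>-agree : {p q : Maybe (Conn m n)} {l : Conn m n} →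
    (∀ {a} → p ≡ just a → a ≡ l) → q ≡ just l → (p <∣> q) ≡ just l
  <∣>-agree {just a}  agree _  = cong just (agree refl)
  <∣>-agree {nothing} _     eq = eq

  module Identify (G : MixedGraph m n) {u v : Vertex G} (u≢v : u ≢ v)
    (nonadjacent : adj G u v ≡ nothing)
    (agree : ∀ {y a b} → adj G u y ≡ just a → adj G v y ≡ just b → a ≡ b) where

    merged-adj : Vertex G → Vertex G → Maybe (Conn m n)
    merged-adj x y = adj G x y <∣> adj G (redirect u v x) (redirect u v y)

    merged : MixedGraph m n
    merged = record
      { order    = order G
      ; adj      = merged-adj
      ; loopless = λ x → cong₂ _<∣>_ (loopless G x) (loopless G (redirect u v x))
      ; symm     = λ x y → trans
          (cong₂ _<∣>_ (symm G x y) (symm G (redirect u v x) (redirect u v y)))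
          (sym (map-<∣> rev (adj G x y) (adj G (redirect u v x) (redirect u v y))))
      }

    inherit : ∀ {y l} → y ≢ v → adj G v y ≡ just l → merged-adj u y ≡ just l
    inherit {y} y≢v evy = <∣>-agree (λ euy → agree euy evy)
      (trans (cong₂ (adj G) (redirect-hit u v) (redirect-miss u v y≢u)) evy)
      where
      y≢u : y ≢ u
      y≢u refl with trans (sym evy) (trans (symm G u v) (cong (map rev) nonadjacent))
      ... | ()

    collapse-preserves : ∀ x y (l : Conn m n) → adj G x y ≡ just l →
      merged-adj (redirect v u x) (redirect v u y) ≡ just l
    collapse-preserves x y l e = by-cases (x ≟ v) (y ≟ v)
      where
      Lands : Vertex G → Vertex G → Set
      Lands p q = merged-adj p q ≡ just l

      by-cases : Dec (x ≡ v) → Dec (y ≡ v) → Lands (redirect v u x) (redirect v u y)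
      by-cases (yes refl) (yes refl) = ⊥-elim (adjacent⇒distinct G e refl)
      by-cases (yes refl) (no y≢v) =
        subst₂ Lands (sym (redirect-hit v u)) (sym (redirect-miss v u y≢v)) (inherit y≢v e)
      -- an arc/edge x v: inherit the reversed one v x at u, then flip back.
      by-cases (no x≢v) (yes refl) =
        subst₂ Lands (sym (redirect-miss v u x≢v)) (sym (redirect-hit v u))
          (trans (symm merged u x)
            (trans (cong (map rev) (inherit x≢v (adj-flip G e))) (cong just (rev-involutive l))))
      by-cases (no x≢v) (no y≢v) =
        subst₂ Lands (sym (redirect-miss v u x≢v)) (sym (redirect-miss v u y≢v))
          (cong (_<∣> adj G (redirect u v x) (redirect u v y)) e)

    collapse : Hom G merged
    collapse = record { fun = redirect v u ; preserve = collapse-preserves }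

    collapse-merges : fun collapse u ≡ fun collapse v
    collapse-merges = trans (redirect-miss v u u≢v) (sym (redirect-hit v u))

  Clash : Maybe (Conn m n) → Maybe (Conn m n) → Set
  Clash (just a) (just b) = a ≢ b
  Clash _        _        = ⊥

  clash? : (p q : Maybe (Conn m n)) → Dec (Clash p q)
  clash? (just a) (just b) with a ≟ᶜ b
  ... | yes a≡b = no λ a≢b → a≢b a≡b
  ... | no  a≢b = yes a≢b
  clash? (just _) nothing  = no λ ()
  clash? nothing  (just _) = no λ ()
  clash? nothing  nothing  = no λ ()

  clashing-neighbour : (G : MixedGraph m n) {u v : Vertex G} → u ≢ v →
    ∀ y → Clash (adj G u y) (adj G v y) → SpecialConnected G u v
  clashing-neighbour G {u} {v} u≢v y clash with adj G u y in euy | adj G v y in evy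
  ... | just a | just b with clash⇒special a b clash
  ...   | inj₁ s = y , inj₁ (u≢v , a , rev b , euy , adj-flip G evy , s)
  ...   | inj₂ s = y , inj₂ ((λ v≡u → u≢v (sym v≡u)) , b , rev a , evy , adj-flip G euy , s)

  no-clash⇒agree : (G : MixedGraph m n) {u v : Vertex G} →
    ¬ (∃ λ y → Clash (adj G u y) (adj G v y)) →
    ∀ {y a b} → adj G u y ≡ just a → adj G v y ≡ just b → a ≡ b
  no-clash⇒agree G noClash {y} {a} {b} euy evy =
    decidable-stable (a ≟ᶜ b) λ a≢b → noClash (y , subst₂ Clash (sym euy) (sym evy) a≢b)

  clique⇒connected : (G : MixedGraph m n) {u v : Vertex G} → u ≢ v →
    RelativeClique G (pair {G = G} u v) → Adjacent G u v ⊎ SpecialConnected G u v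
  clique⇒connected G {u} {v} u≢v clique with adj G u v in euv
  ... | just l  = inj₁ (l , refl)
  ... | nothing with any? (λ y → clash? (adj G u y) (adj G v y))
  ...   | yes (y , clash) = inj₂ (clashing-neighbour G u≢v y clash)
  ...   | no noClash      = ⊥-elim
    (clique merged collapse u v (inj₁ refl) (inj₂ refl) u≢v collapse-merges)
    where open Identify G u≢v euv (no-clash⇒agree G noClash)

proposition1 : (m n : ℕ) (G : MixedGraph m n) (u v : Vertex G) → u ≢ v →
    RelativeClique G (pair {G = G} u v) ⇔ (Adjacent G u v ⊎ SpecialConnected G u v)
proposition1 m n G u v u≢v = mk⇔
  (clique⇒connected G u≢v)
  (λ connected → pair-clique G u v (λ H f → separated G H f connected))
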